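{- Let $p_1\equiv p_2\equiv1\pmod4$ be primes and let $\varepsilon_2=a+b\sqrt{p_1p_2}$ be the fundamental unit of $\mathbb{Q}(\sqrt{p_1p_2})$. If $N(\varepsilon_2)=1$, then neither $a+1$ nor $a-1$ is the square of a natural number.
   Context: $N$ denotes the norm from $\mathbb{Q}(\sqrt{p_1p_2})$ to $\mathbb{Q}$. -}

module Defs where

open import Data.Nat using (ℕ; _*_; _≤_; _%_)
open import Data.Integer as ℤ using (ℤ; +_)
open import Data.Product using (_×_)
open import Data.Sum using (_⊎_)
open import Relation.Binary.PropositionalEquality using (_≡_)

-- Elements of the ring of integers of Q(√d), d ≡ 1 (mod 4) squarefree, are
-- written (x + y√d)/2 with x ≡ y (mod 2).  We represent such an element by
-- the pair (x , y).

-- Norm of (x + y√d)/2, multiplied by 4:  x² - d y².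
norm4 : ℕ → ℕ → ℕ → ℤ
norm4 d x y = (+ x) ℤ.* (+ x) ℤ.- (+ d) ℤ.* ((+ y) ℤ.* (+ y))

-- (x + y√d)/2 is a unit of O_K that is > 1, i.e. x , y ≥ 1, x ≡ y (mod 2)
-- and its norm is ±1.  (A unit u of a real quadratic field satisfies u > 1
-- iff both of its coordinates are positive.)
IsUnitGt1 : ℕ → ℕ → ℕ → Set
IsUnitGt1 d x y =
  (1 ≤ x) × (1 ≤ y) × (x % 2 ≡ y % 2) ×
  ((norm4 d x y ≡ + 4) ⊎ (norm4 d x y ≡ ℤ.- (+ 4)))

-- ε = (x + y√d)/2 is the fundamental unit: the smallest unit > 1.
-- Among units > 1 the order agrees with the order of the √d-coordinate.
IsFundamentalUnit : ℕ → ℕ → ℕ → Set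
IsFundamentalUnit d x y =
  IsUnitGt1 d x y × (∀ x' y' → IsUnitGt1 d x' y' → y ≤ y')

{-# OPTIONS --safe #-}
-- Write a = x/2 and b = y/2: x is even in either case, hence so is y (d = p₁p₂
-- is odd), and a² − d b² = 1 with b ≠ 0.  If a ± 1 = n² with n odd, then a is
-- even and d b² = a² − 1 ≡ 3 (mod 4), impossible as d ≡ 1 (mod 4) forces
-- d b² ≡ b² ≡ 0 or 1.  If n = 2m, then d b² = (a − 1)(a + 1) = 2 n² (2m² ∓ 1)
-- has odd 2-adic valuation, whereas that of d b² is even unless b = 0.
module Submission where

open import Defs
open import Data.Nat using (ℕ; zero; suc; _+_; _*_; _%_; _/_; _<_; s≤s; z≤n)
open import Data.Nat.Primality using (Prime)
open import Data.Nat.Properties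
  using (even≢odd; +-comm; *-comm; *-suc; +-cancelʳ-≡; *-cancelˡ-≡; *-distribˡ-+; m<m+n; m+1+n≢0; m<n⇒n≢0)
open import Data.Nat.DivMod using (m≡m%n+[m/n]*n)
open import Data.Nat.Induction using (<-wellFounded)
open import Data.Nat.Tactic.RingSolver using (solve-∀; solve)
open import Data.Integer using (ℤ; +_)
import Data.Integer as ℤ
import Data.Integer.Properties as ℤ
open import Algebra.Properties.AbelianGroup ℤ.+-0-abelianGroup using (//-rightDividesˡ)
open import Data.List using ([]; _∷_)
open import Data.Product using (_×_; _,_; ∃-syntax)
open import Data.Empty using (⊥-elim)
open import Induction.WellFounded using (Acc; acc)
open import Relation.Binary.PropositionalEquality
  using (_≡_; _≢_; refl; sym; trans; cong; cong₂; subst; module ≡-Reasoning)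
open import Relation.Nullary using (¬_)

open ≡-Reasoning

record PellEq (d k x y : ℕ) : Set where
  constructor pellEq
  field
    equation : x * x ≡ d * (y * y) + k

Odd : ℕ → Set
Odd n = ∃[ k ] n ≡ 1 + 2 * k

OneMod4 : ℕ → Set
OneMod4 n = ∃[ q ] n ≡ 1 + 4 * q

data EvenOrOdd : ℕ → Set where
  even : ∀ k → EvenOrOdd (2 * k)
  odd  : ∀ k → EvenOrOdd (1 + 2 * k)

evenOrOdd : ∀ n → EvenOrOdd n
evenOrOdd zero = even 0
evenOrOdd (suc n) with evenOrOdd n
... | even k = odd k
... | odd k  = subst EvenOrOdd (*-suc 2 k) (even (suc k))

odd≢even : ∀ {m n} → Odd n → n ≢ 2 * m
odd≢even {m} (k , refl) eq = even≢odd m k (sym eq)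

odd-* : ∀ {m n} → Odd m → Odd n → Odd (m * n)
odd-* (j , refl) (k , refl) = j + k + 2 * j * k , solve (j ∷ k ∷ [])

oneMod4-* : ∀ {m n} → OneMod4 m → OneMod4 n → OneMod4 (m * n)
oneMod4-* (q , refl) (r , refl) = q + r + 4 * q * r , solve (q ∷ r ∷ [])

oneMod4⇒odd : ∀ {n} → OneMod4 n → Odd n
oneMod4⇒odd (q , refl) = 2 * q , solve (q ∷ [])

%4≡1⇒oneMod4 : ∀ n → n % 4 ≡ 1 → OneMod4 n
%4≡1⇒oneMod4 n n%4≡1 = n / 4 , (begin
  n                  ≡⟨ m≡m%n+[m/n]*n n 4 ⟩
  n % 4 + n / 4 * 4  ≡⟨ cong₂ _+_ n%4≡1 (*-comm (n / 4) 4) ⟩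
  1 + 4 * (n / 4)    ∎)

odd²-oneMod4 : ∀ k → OneMod4 ((1 + 2 * k) * (1 + 2 * k))
odd²-oneMod4 k = k * k + k , solve (k ∷ [])

double-square : ∀ n → 2 * n * (2 * n) ≡ 2 * (2 * (n * n))
double-square = solve-∀

*-double-square : ∀ m n → m * (2 * n * (2 * n)) ≡ 2 * (2 * (m * (n * n)))
*-double-square = solve-∀

2*odd*square≡odd*square⇒≡0 : ∀ {s d} → Odd s → Odd d →
  ∀ m c → 2 * (s * (m * m)) ≡ d * (c * c) → c ≡ 0
2*odd*square≡odd*square⇒≡0 {s} {d} s-odd d-odd m c = descend m c (<-wellFounded c)
  where
  descend : ∀ m c → Acc _<_ c → 2 * (s * (m * m)) ≡ d * (c * c) → c ≡ 0
  descend-half : ∀ m k → Acc _<_ k → s * (m * m) ≡ 2 * (d * (k * k)) → k ≡ 0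

  descend m c (acc rec) eq with evenOrOdd c
  ... | odd k        = ⊥-elim (odd≢even {s * (m * m)} (odd-* d-odd (odd-* (k , refl) (k , refl))) (sym eq))
  ... | even zero    = refl
  ... | even (suc k) = cong (2 *_) (descend-half m (suc k) (rec (m<m+n (suc k) (s≤s z≤n)))
                         (*-cancelˡ-≡ _ _ 2 (trans eq (*-double-square d (suc k)))))

  descend-half m k ac eq with evenOrOdd m
  ... | odd j  = ⊥-elim (odd≢even {d * (k * k)} (odd-* s-odd (odd-* (j , refl) (j , refl))) eq)
  ... | even j = descend j k ac (*-cancelˡ-≡ _ _ 2 (trans (sym (*-double-square s j)) eq))

¬pellEq-even : ∀ {d a b} k → OneMod4 d → PellEq d 1 a b → a ≢ 2 * k
¬pellEq-even {d} {b = b} k d≡1 (pellEq eq) refl with evenOrOdd b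
... | even j = even≢odd (2 * (k * k)) (2 * (d * (j * j))) (begin
  2 * (2 * (k * k))            ≡⟨ double-square k ⟨
  2 * k * (2 * k)              ≡⟨ eq ⟩
  d * (2 * j * (2 * j)) + 1    ≡⟨ +-comm _ 1 ⟩
  1 + d * (2 * j * (2 * j))    ≡⟨ cong suc (*-double-square d j) ⟩
  1 + 2 * (2 * (d * (j * j)))  ∎)
... | odd j with oneMod4-* d≡1 (odd²-oneMod4 j)
...   | Q , d*b²≡1+4Q = even≢odd (k * k) Q (*-cancelˡ-≡ _ _ 2 (begin
  2 * (2 * (k * k))  ≡⟨ double-square k ⟨
  2 * k * (2 * k)    ≡⟨ eq ⟩
  d * (b * b) + 1    ≡⟨ cong (_+ 1) d*b²≡1+4Q ⟩
  1 + 4 * Q + 1      ≡⟨ solve (Q ∷ []) ⟩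
  2 * (1 + 2 * Q)    ∎))

pellEq₄-halve : ∀ {d x y a} → Odd d → PellEq d 4 x y → x ≡ 2 * a →
  ∃[ b ] y ≡ 2 * b × PellEq d 1 a b
pellEq₄-halve {d} {y = y} {a} d-odd (pellEq eq) refl with evenOrOdd y
... | even b = b , refl , pellEq (*-cancelˡ-≡ _ _ 2 (*-cancelˡ-≡ _ _ 2 (begin
  2 * (2 * (a * a))            ≡⟨ double-square a ⟨
  2 * a * (2 * a)              ≡⟨ eq ⟩
  d * (2 * b * (2 * b)) + 4    ≡⟨ cong (_+ 4) (*-double-square d b) ⟩
  2 * (2 * (d * (b * b))) + 4  ≡⟨ solve (d ∷ b ∷ []) ⟩
  2 * (2 * (d * (b * b) + 1))  ∎)))
... | odd j with odd-* d-odd (odd-* (j , refl) (j , refl))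
...   | r , d*y²≡1+2r = ⊥-elim (even≢odd (2 * (a * a)) (r + 2) (begin
  2 * (2 * (a * a))  ≡⟨ double-square a ⟨
  2 * a * (2 * a)    ≡⟨ eq ⟩
  d * (y * y) + 4    ≡⟨ cong (_+ 4) d*y²≡1+2r ⟩
  1 + 2 * r + 4      ≡⟨ solve (r ∷ []) ⟩
  1 + 2 * (r + 2)    ∎))

pellEq-[a²≡2sm²+1]⇒b≡0 : ∀ {d a b s} → Odd d → Odd s → PellEq d 1 a b →
  ∀ m → a * a ≡ 2 * (s * (m * m)) + 1 → b ≡ 0
pellEq-[a²≡2sm²+1]⇒b≡0 {b = b} d-odd s-odd (pellEq a²≡db²+1) m a²≡2sm²+1 =
  2*odd*square≡odd*square⇒≡0 s-odd d-odd m b (+-cancelʳ-≡ 1 _ _ (trans (sym a²≡2sm²+1) a²≡db²+1))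

pellEq-[a+1≡n²]⇒b≡0 : ∀ {d a b n} → OneMod4 d → PellEq d 1 a b → a + 1 ≡ n * n → b ≡ 0
pellEq-[a+1≡n²]⇒b≡0 {a = a} {n = n} d≡1 pell a+1≡n² with evenOrOdd n
... | odd k = ⊥-elim (¬pellEq-even (2 * (k * k + k)) d≡1 pell (+-cancelʳ-≡ 1 _ _ (begin
  a + 1                      ≡⟨ a+1≡n² ⟩
  (1 + 2 * k) * (1 + 2 * k)  ≡⟨ solve (k ∷ []) ⟩
  2 * (2 * (k * k + k)) + 1  ∎)))
... | even zero = ⊥-elim (m+1+n≢0 a a+1≡n²)
... | even (suc j) =
  pellEq-[a²≡2sm²+1]⇒b≡0 (oneMod4⇒odd d≡1) (j * j + 2 * j , refl) pell n (begin
    a * a                                                  ≡⟨ cong (λ a → a * a) a≡ ⟩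
    (3 + 8 * j + 4 * (j * j)) * (3 + 8 * j + 4 * (j * j))  ≡⟨ solve (j ∷ []) ⟩
    2 * ((1 + 2 * (j * j + 2 * j)) * (2 * (1 + j) * (2 * (1 + j)))) + 1  ∎)
  where
  a≡ : a ≡ 3 + 8 * j + 4 * (j * j)
  a≡ = +-cancelʳ-≡ 1 _ _ (begin
    a + 1                        ≡⟨ a+1≡n² ⟩
    2 * (1 + j) * (2 * (1 + j))  ≡⟨ solve (j ∷ []) ⟩
    3 + 8 * j + 4 * (j * j) + 1  ∎)

pellEq-[a≡n²+1]⇒b≡0 : ∀ {d a b n} → OneMod4 d → PellEq d 1 a b → a ≡ n * n + 1 → b ≡ 0
pellEq-[a≡n²+1]⇒b≡0 {n = n} d≡1 pell refl with evenOrOdd n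
... | odd k  = ⊥-elim (¬pellEq-even (2 * (k * k + k) + 1) d≡1 pell (solve (k ∷ [])))
... | even m = pellEq-[a²≡2sm²+1]⇒b≡0 (oneMod4⇒odd d≡1) (m * m , refl) pell (2 * m) (solve (m ∷ []))

norm4≡+4⇒pellEq : ∀ d x y → norm4 d x y ≡ + 4 → PellEq d 4 x y
norm4≡+4⇒pellEq d x y N≡4 = pellEq (ℤ.+-injective (begin
  x²                   ≡⟨ //-rightDividesˡ dy² x² ⟨
  x² ℤ.- dy² ℤ.+ dy²   ≡⟨ cong (ℤ._+ dy²) (trans norm4-pos N≡4) ⟩
  + 4 ℤ.+ dy²          ≡⟨ ℤ.+-comm (+ 4) dy² ⟩
  + (d * (y * y) + 4)  ∎))
  where
  x² dy² : ℤ
  x²  = + (x * x)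
  dy² = + (d * (y * y))
  norm4-pos : x² ℤ.- dy² ≡ norm4 d x y
  norm4-pos = cong₂ ℤ._-_ (ℤ.pos-* x x) (trans (ℤ.pos-* d (y * y)) (cong (+ d ℤ.*_) (ℤ.pos-* y y)))

x+2≡2*m⇒∃[a]x≡2*a×a+1≡m : ∀ x m → x + 2 ≡ 2 * m → ∃[ a ] x ≡ 2 * a × a + 1 ≡ m
x+2≡2*m⇒∃[a]x≡2*a×a+1≡m x zero    eq = ⊥-elim (m+1+n≢0 x eq)
x+2≡2*m⇒∃[a]x≡2*a×a+1≡m x (suc a) eq =
  a , +-cancelʳ-≡ 2 _ _ (trans eq (trans (*-suc 2 a) (+-comm 2 (2 * a)))) , +-comm a 1

lemma7 : (p₁ p₂ : ℕ) → Prime p₁ → Prime p₂ → p₁ ≢ p₂ →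
    p₁ % 4 ≡ 1 → p₂ % 4 ≡ 1 →
    (x y : ℕ) → IsFundamentalUnit (p₁ * p₂) x y →
    norm4 (p₁ * p₂) x y ≡ + 4 →
    (n : ℕ) → ¬ (x + 2 ≡ 2 * (n * n)) × ¬ (x ≡ 2 * (n * n) + 2)
lemma7 p₁ p₂ _ _ _ p₁%4≡1 p₂%4≡1 x y ((_ , 1≤y , _) , _) N≡4 n = x+2≢2n² , x≢2n²+2
  where
  d≡1 : OneMod4 (p₁ * p₂)
  d≡1 = oneMod4-* (%4≡1⇒oneMod4 p₁ p₁%4≡1) (%4≡1⇒oneMod4 p₂ p₂%4≡1)

  nontrivial-half : ∀ {a} → x ≡ 2 * a → ∃[ b ] b ≢ 0 × PellEq (p₁ * p₂) 1 a b
  nontrivial-half {a} x≡2a =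
    let b , y≡2b , pell = pellEq₄-halve {a = a} (oneMod4⇒odd d≡1) (norm4≡+4⇒pellEq (p₁ * p₂) x y N≡4) x≡2a
    in b , (λ b≡0 → m<n⇒n≢0 1≤y (trans y≡2b (cong (2 *_) b≡0))) , pell

  x+2≢2n² : ¬ (x + 2 ≡ 2 * (n * n))
  x+2≢2n² x+2≡2n² =
    let a , x≡2a , a+1≡n² = x+2≡2*m⇒∃[a]x≡2*a×a+1≡m x (n * n) x+2≡2n²
        b , b≢0 , pell = nontrivial-half x≡2a
    in b≢0 (pellEq-[a+1≡n²]⇒b≡0 {n = n} d≡1 pell a+1≡n²)

  x≢2n²+2 : ¬ (x ≡ 2 * (n * n) + 2)
  x≢2n²+2 x≡2n²+2 =
    let b , b≢0 , pell = nontrivial-half {n * n + 1} (trans x≡2n²+2 (sym (*-distribˡ-+ 2 (n * n) 1)))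
    in b≢0 (pellEq-[a≡n²+1]⇒b≡0 {n = n} d≡1 pell refl)
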